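{- Let $\Gamma$ be a girth-regular graph of valence $k$, girth $g$ and signature $(a_1,\ldots,a_k)$. Then $a_k \le (k-1)^d$, where $d=\lfloor g/2\rfloor$.
   Context: Graphs are finite and simple. For a graph $\Gamma$ of finite girth $g$, a girth cycle is a cycle of length $g$, and for an edge $e$, $\epsilon(e)$ denotes the number of girth cycles containing $e$. If $v$ is a vertex with incident edges $e_1,\ldots,e_k$ ordered so that $\epsilon(e_1)\le\cdots\le\epsilon(e_k)$, the signature of $v$ is the $k$-tuple $(\epsilon(e_1),\ldots,\epsilon(e_k))$. A graph is girth-regular if all its vertices have the same signature; this common tuple is the signature of the graph (in particular a girth-regular graph is regular). -}

module Defs where

open import Data.Nat using (ℕ; zero; suc; _∸_; _≤_; _<_)
open import Data.Nat.Properties using (≤-decTotalOrder)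
open import Data.Bool using (Bool; T)
open import Data.Fin using (Fin)
open import Data.Fin.Properties using (all?; _≟_)
open import Data.Vec using (Vec; []; _∷_; lookup; head; last)
open import Data.List using (List; []; _∷_; length; filter; map; concatMap)
open import Data.List.Membership.Propositional using (_∈_)
open import Data.Product using (_×_; _,_; ∃-syntax)
open import Data.Unit using (⊤)
open import Relation.Nullary using (¬_; Dec; yes; no)
open import Relation.Nullary.Decidable using (_×-dec_; _→-dec_)
open import Relation.Binary.PropositionalEquality using (_≡_)
open import Data.List.Sort ≤-decTotalOrder using (sort)

record Graph : Set where
  field
    n      : ℕ
    adj    : Fin n → Fin n → Bool
    sym    : ∀ u v → adj u v ≡ adj v u
    irrefl : ∀ v → adj v v ≡ Data.Bool.false

module _ (Γ : Graph) where
  open Graph Γ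

  _~_ : Fin n → Fin n → Set
  u ~ v = T (adj u v)

  _~?_ : (u v : Fin n) → Dec (u ~ v)
  u ~? v = Data.Bool.T? (adj u v)

  vertices : List (Fin n)
  vertices = Data.List.allFin n

  neighbours : Fin n → List (Fin n)
  neighbours v = filter (v ~?_) vertices

  degree : Fin n → ℕ
  degree v = length (neighbours v)

  Consecutive : ∀ {ℓ} → Vec (Fin n) ℓ → Set
  Consecutive []           = ⊤
  Consecutive (x ∷ [])     = ⊤
  Consecutive (x ∷ y ∷ xs) = (x ~ y) × Consecutive (y ∷ xs)

  consecutive? : ∀ {ℓ} (s : Vec (Fin n) ℓ) → Dec (Consecutive s)
  consecutive? []           = yes Data.Unit.tt
  consecutive? (x ∷ [])     = yes Data.Unit.tt
  consecutive? (x ∷ y ∷ xs) = (x ~? y) ×-dec consecutive? (y ∷ xs)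

  Distinct : ∀ {ℓ} → Vec (Fin n) ℓ → Set
  Distinct {ℓ} s = ∀ i j → lookup s i ≡ lookup s j → i ≡ j

  distinct? : ∀ {ℓ} (s : Vec (Fin n) ℓ) → Dec (Distinct s)
  distinct? s = all? λ i → all? λ j → (lookup s i ≟ lookup s j) →-dec (i ≟ j)

  -- A cycle of length ℓ (ℓ ≥ 3), written as a cyclic sequence of
  -- distinct vertices v₀ v₁ … v_{ℓ-1} with v_i ~ v_{i+1} and v_{ℓ-1} ~ v₀.
  -- (A cycle subgraph of length ℓ corresponds to exactly 2ℓ such sequences:
  -- ℓ choices of starting vertex and 2 orientations.)
  IsCycleSeq : (ℓ : ℕ) → Vec (Fin n) (suc ℓ) → Set
  IsCycleSeq ℓ s = Distinct s × Consecutive s × (last s ~ head s)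

  isCycleSeq? : (ℓ : ℕ) (s : Vec (Fin n) (suc ℓ)) → Dec (IsCycleSeq ℓ s)
  isCycleSeq? ℓ s = distinct? s ×-dec (consecutive? s ×-dec (last s ~? head s))

  HasCycleOfLength : ℕ → Set
  HasCycleOfLength zero    = Data.Empty.⊥
    where import Data.Empty
  HasCycleOfLength (suc m) = (3 ≤ suc m) × ∃[ s ] IsCycleSeq m s

  HasGirth : ℕ → Set
  HasGirth g = HasCycleOfLength g × (∀ ℓ → ℓ < g → ¬ HasCycleOfLength ℓ)

  allVecs : (ℓ : ℕ) → List (Vec (Fin n) ℓ)
  allVecs zero    = [] ∷ []
  allVecs (suc ℓ) = concatMap (λ x → map (x ∷_) (allVecs ℓ)) vertices

  -- ε(uv) for a graph of girth g (g ≥ 3): the number of girth cycles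
  -- containing the edge uv.  A girth cycle through uv corresponds to
  -- exactly one girth cycle sequence of the form u, v, w₂, …, w_{g-1}.
  ε : (g : ℕ) → Fin n → Fin n → ℕ
  ε g u v = length (filter (λ r → isCycleSeq? (suc (g ∸ 2)) (u ∷ v ∷ r)) (allVecs (g ∸ 2)))

  signature : (g : ℕ) → Fin n → List ℕ
  signature g v = sort (map (ε g v) (neighbours v))

  Regular : ℕ → Set
  Regular k = ∀ v → degree v ≡ k

  GirthRegularWithSignature : ℕ → List ℕ → Set
  GirthRegularWithSignature g σ = ∀ v → signature g v ≡ σ

module Submission where

-- Every entry of the signature is some ε(uv), so
-- it suffices to show that every edge uv lies on at most (k-1)^d girth cycles.
-- A girth cycle through uv is a vertex sequence u, v, w₂, …, w_{g-1}.
--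
-- The cycle is determined by w₂ … w_{d+1}: the remaining
--    stretch w_{d+1} … w_{g-1}, u is a non-backtracking walk of length
--    t = ⌊(g-1)/2⌋, and two different such walks with the same ends join
--    (one of them reversed) into a non-backtracking walk of length 2t + 1
--    repeating a vertex, which contains a cycle of length ≤ 2t < g.
--  * Counting.  Sequences extending the edge u → v to a non-backtracking
--    walk and determined by their first d entries number at most (k-1)^d,
--    since every step has at most k - 1 choices.

open import Defs
open import Data.Nat using (ℕ; zero; suc; _+_; _*_; _∸_; _^_; _/_; _≤_; _<_; z≤n; s≤s; ⌊_/2⌋)
open import Data.Nat.Properties
  using (≤-trans; ≤-<-trans; ≤-pred; n≤1+n; m<n⇒m<1+n; m<m+n; +-suc; +-comm; +-identityʳ;
         +-mono-≤; +-monoʳ-≤; *-monoˡ-≤; +-cancelˡ-≡; suc-injective; m+[n∸m]≡n;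
         ⌊n/2⌋≤⌈n/2⌉; ⌊n/2⌋+⌈n/2⌉≡n; ⌈n/2⌉<n; ≤-decTotalOrder; module ≤-Reasoning)
open import Data.Nat.DivMod using (m/n≡1+[m∸n]/n)
open import Data.Nat.ListAction using (sum)
open import Data.List using (List; []; _∷_; _++_; _∷ʳ_; _ʳ++_; [_]; length; filter; map; concatMap; take; drop; last)
open import Data.List.Properties
  using (length-++; ++-assoc; filter-++; ∷ʳ-injectiveˡ; length-ʳ++; length-drop; take++drop≡id;
         filter-notAll; filter-none; filter-accept; filter-reject; length-filter; map-cong)
open import Data.List.Membership.Propositional using (_∈_; _∉_)
open import Data.List.Membership.Propositional.Properties using (∈-++⁺ˡ; ∈-++⁺ʳ; ∈-∃++; ∈-allFin; ∈-filter⁺; ∈-filter⁻; ∈-map⁻)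
open import Data.List.Relation.Unary.Any using (here; there)
import Data.List.Relation.Unary.Any as Any
open import Data.List.Relation.Unary.All using (All; []; _∷_)
import Data.List.Relation.Unary.All as All
open import Data.List.Relation.Unary.AllPairs using (_∷_)
open import Data.List.Relation.Unary.Unique.Propositional using (Unique)
open import Data.List.Relation.Unary.Unique.Propositional.Properties using (allFin⁺)
open import Data.List.Relation.Binary.Permutation.Propositional.Properties using (∈-resp-↭)
open import Data.List.Sort ≤-decTotalOrder using (sort-↭)
open import Data.Vec as V using (Vec; toList; fromList)
open import Data.Vec.Properties using (toList∘fromList; toList-injective; cast-is-id; length-toList; ∷-injectiveˡ; ∷-injectiveʳ)
open import Data.Vec.Membership.Propositional using () renaming (_∈_ to _∈ᵥ_)
open import Data.Vec.Membership.Propositional.Properties using (∈-lookup; ∈-toList⁺)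
import Data.Fin as Fin
open Fin using (Fin)
open import Data.Bool using (T)
open import Data.Fin.Properties using (_≟_; 0≢1+n) renaming (suc-injective to suc-injectiveᶠ)
open import Data.Maybe using (just)
open import Data.Maybe.Properties using (just-injective)
open import Data.Product using (Σ; ∃-syntax; _×_; _,_; proj₁; proj₂)
open import Data.Unit using (⊤; tt)
open import Data.Empty using (⊥-elim)
open import Function using (_∘_)
open import Relation.Unary using (Decidable)
open import Relation.Nullary using (¬_; Dec; yes; no; ¬?)
open import Relation.Nullary.Decidable using (_×-dec_)
open import Relation.Binary.PropositionalEquality
  using (_≡_; _≢_; refl; sym; trans; cong; cong₂; subst; module ≡-Reasoning)

-- The statement is phrased with ℕ-division, whereas ⌊_/2⌋ computes by
-- structural recursion and is the convenient form for the arithmetic below.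
/2≡⌊/2⌋ : ∀ n → n / 2 ≡ ⌊ n /2⌋
/2≡⌊/2⌋ zero          = refl
/2≡⌊/2⌋ (suc zero)    = refl
/2≡⌊/2⌋ (suc (suc n)) = trans (m/n≡1+[m∸n]/n {suc (suc n)} {2} (s≤s (s≤s z≤n))) (cong suc (/2≡⌊/2⌋ n))

⌊n/2⌋+⌊n/2⌋≤n : ∀ n → ⌊ n /2⌋ + ⌊ n /2⌋ ≤ n
⌊n/2⌋+⌊n/2⌋≤n n =
  subst (⌊ n /2⌋ + ⌊ n /2⌋ ≤_) (⌊n/2⌋+⌈n/2⌉≡n n) (+-monoʳ-≤ ⌊ n /2⌋ (⌊n/2⌋≤⌈n/2⌉ n))

halves-of-pred : ∀ m → ⌊ suc (suc m) /2⌋ + ⌊ suc m /2⌋ ≡ suc m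
halves-of-pred m = trans (+-comm ⌊ suc (suc m) /2⌋ ⌊ suc m /2⌋) (⌊n/2⌋+⌈n/2⌉≡n (suc m))

half≤ : ∀ m → 1 ≤ m → ⌊ suc (suc m) /2⌋ ≤ m
half≤ (suc m) _ = ≤-pred (⌈n/2⌉<n m)

-- Once a prefix of length ⌊g/2⌋ of the m entries is fixed, the rest of
-- the cycle back to its start has length ⌊(g-1)/2⌋.
remaining-length : ∀ m → 1 ≤ m → suc (m ∸ ⌊ suc (suc m) /2⌋) ≡ ⌊ suc m /2⌋
remaining-length m 1≤m = +-cancelˡ-≡ d (suc (m ∸ d)) ⌊ suc m /2⌋ (begin
  d + suc (m ∸ d)   ≡⟨ +-suc d (m ∸ d) ⟩
  suc (d + (m ∸ d)) ≡⟨ cong suc (m+[n∸m]≡n (half≤ m 1≤m)) ⟩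
  suc m             ≡⟨ sym (halves-of-pred m) ⟩
  d + ⌊ suc m /2⌋   ∎)
  where
  open ≡-Reasoning
  d = ⌊ suc (suc m) /2⌋

<⇒≤∸1 : ∀ {m k} → m < k → m ≤ k ∸ 1
<⇒≤∸1 (s≤s m≤k) = m≤k

length-filter-map : ∀ {A B : Set} {P : B → Set} (P? : Decidable P) (f : A → B) xs →
  length (filter P? (map f xs)) ≡ length (filter (P? ∘ f) xs)
length-filter-map P? f [] = refl
length-filter-map P? f (x ∷ xs) with P? (f x)
... | yes _ = cong suc (length-filter-map P? f xs)
... | no _  = length-filter-map P? f xs

length-filter-concatMap : ∀ {A B : Set} {P : B → Set} (P? : Decidable P) (F : A → List B) xs →
  length (filter P? (concatMap F xs)) ≡ sum (map (λ x → length (filter P? (F x))) xs)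
length-filter-concatMap P? F [] = refl
length-filter-concatMap P? F (x ∷ xs) = begin
  length (filter P? (F x ++ concatMap F xs))
    ≡⟨ cong length (filter-++ P? (F x) (concatMap F xs)) ⟩
  length (filter P? (F x) ++ filter P? (concatMap F xs))
    ≡⟨ length-++ (filter P? (F x)) ⟩
  length (filter P? (F x)) + length (filter P? (concatMap F xs))
    ≡⟨ cong (length (filter P? (F x)) +_) (length-filter-concatMap P? F xs) ⟩
  length (filter P? (F x)) + sum (map (λ x → length (filter P? (F x))) xs) ∎
  where open ≡-Reasoning

filter-× : ∀ {A : Set} {P Q : A → Set} (P? : Decidable P) (Q? : Decidable Q) xs →
  filter (λ x → P? x ×-dec Q? x) xs ≡ filter Q? (filter P? xs)
filter-× P? Q? [] = refl
filter-× P? Q? (x ∷ xs) with P? x | Q? x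
... | yes _ | yes q = trans (cong (x ∷_) (filter-× P? Q? xs)) (sym (filter-accept Q? q))
... | yes _ | no ¬q = trans (filter-× P? Q? xs) (sym (filter-reject Q? ¬q))
... | no _  | _     = filter-× P? Q? xs

toList-injective≡ : ∀ {A : Set} {ℓ} (r r′ : Vec A ℓ) → toList r ≡ toList r′ → r ≡ r′
toList-injective≡ r r′ eq = trans (sym (cast-is-id refl r)) (toList-injective refl r r′ eq)

filter-witness : ∀ {A : Set} {P : A → Set} (P? : Decidable P) xs → 0 < length (filter P? xs) → Σ A P
filter-witness P? (x ∷ xs) pos with P? x
... | yes px = x , px
... | no _   = filter-witness P? xs pos

sum-bound : ∀ {A : Set} {S : A → Set} (S? : Decidable S) (f : A → ℕ) B xs →
  (∀ x → S x → f x ≤ B) → (∀ x → ¬ S x → f x ≡ 0) → sum (map f xs) ≤ length (filter S? xs) * B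
sum-bound S? f B [] _ _ = z≤n
sum-bound S? f B (x ∷ xs) onS offS with S? x
... | yes s = +-mono-≤ (onS x s) (sum-bound S? f B xs onS offS)
... | no ¬s rewrite offS x ¬s = sum-bound S? f B xs onS offS

sum-zero : ∀ {A : Set} (f : A → ℕ) xs → All (λ x → f x ≡ 0) xs → sum (map f xs) ≡ 0
sum-zero f [] [] = refl
sum-zero f (x ∷ xs) (fx≡0 ∷ rest) rewrite fx≡0 = sum-zero f xs rest

sum-atMost1 : ∀ {A : Set} (f : A → ℕ) xs → Unique xs → (∀ x → f x ≤ 1) →
  (∀ x y → 0 < f x → 0 < f y → x ≡ y) → sum (map f xs) ≤ 1
sum-atMost1 f [] _ _ _ = z≤n
sum-atMost1 f (x ∷ xs) (x∉xs ∷ unique) f≤1 single with f x in fx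
... | zero  = sum-atMost1 f xs unique f≤1 single
... | suc c = begin
  suc c + sum (map f xs) ≡⟨ cong (suc c +_) (sum-zero f xs (All.map vanish x∉xs)) ⟩
  suc c + 0              ≡⟨ +-identityʳ (suc c) ⟩
  suc c                  ≡⟨ sym fx ⟩
  f x                    ≤⟨ f≤1 x ⟩
  1                      ∎
  where
  open ≤-Reasoning
  vanish : ∀ {y} → x ≢ y → f y ≡ 0
  vanish {y} x≢y with f y in fy
  ... | zero  = refl
  ... | suc _ = ⊥-elim (x≢y (single x y (subst (0 <_) (sym fx) (s≤s z≤n)) (subst (0 <_) (sym fy) (s≤s z≤n))))

-- Walks, cycles and counting in a fixed graph Γ.
module _ (Γ : Graph) where
  open Graph Γ using (n)
  open import Data.List.Membership.DecPropositional (_≟_ {n}) using (_∈?_)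

  Vertex : Set
  Vertex = Fin n

  _∼_ : Vertex → Vertex → Set
  x ∼ y = _~_ Γ x y

  ∼-sym : ∀ {x y} → x ∼ y → y ∼ x
  ∼-sym {x} {y} = subst T (Graph.sym Γ x y)

  ∼-irrefl : ∀ {x} → ¬ x ∼ x
  ∼-irrefl {x} = subst T (Graph.irrefl Γ x)

  Walk : List Vertex → Set
  Walk []          = ⊤
  Walk (x ∷ [])    = ⊤
  Walk (x ∷ y ∷ l) = x ∼ y × Walk (y ∷ l)

  NoBacktrack : List Vertex → Set
  NoBacktrack (x ∷ y ∷ z ∷ l) = x ≢ z × NoBacktrack (y ∷ z ∷ l)
  NoBacktrack _               = ⊤

  NBWalk : List Vertex → Set
  NBWalk l = Walk l × NoBacktrack l

  NoDup : List Vertex → Set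
  NoDup []      = ⊤
  NoDup (x ∷ l) = x ∉ l × NoDup l

  noDup? : ∀ l → Dec (NoDup l)
  noDup? []      = yes tt
  noDup? (x ∷ l) = ¬? (x ∈? l) ×-dec noDup? l

  endpoint : Vertex → List Vertex → Vertex
  endpoint x []      = x
  endpoint x (y ∷ l) = endpoint y l

  endpoint∈ : ∀ x l → endpoint x l ∈ x ∷ l
  endpoint∈ x []      = here refl
  endpoint∈ x (y ∷ l) = there (endpoint∈ y l)

  endpoint-∷ʳ : ∀ x l y → endpoint x (l ∷ʳ y) ≡ y
  endpoint-∷ʳ x []      y = refl
  endpoint-∷ʳ x (z ∷ l) y = endpoint-∷ʳ z l y

  nbwalk-tail : ∀ x l → NBWalk (x ∷ l) → NBWalk l
  nbwalk-tail x []          _              = tt , tt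
  nbwalk-tail x (y ∷ [])    _              = tt , tt
  nbwalk-tail x (y ∷ z ∷ l) ((_ , w) , nb) = w , proj₂ nb

  nbwalk-suffix : ∀ x p l → NBWalk (x ∷ p ++ l) → NBWalk (endpoint x p ∷ l)
  nbwalk-suffix x []      l w = w
  nbwalk-suffix x (y ∷ p) l w = nbwalk-suffix y p l (nbwalk-tail x (y ∷ p ++ l) w)

  noDup→noBacktrack : ∀ l → NoDup l → NoBacktrack l
  noDup→noBacktrack []              _            = tt
  noDup→noBacktrack (x ∷ [])        _            = tt
  noDup→noBacktrack (x ∷ y ∷ [])    _            = tt
  noDup→noBacktrack (x ∷ y ∷ z ∷ l) (x∉ , nd) = (λ x≡z → x∉ (there (here x≡z))) , noDup→noBacktrack (y ∷ z ∷ l) nd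

  noDup-prefix : ∀ p l → NoDup (p ++ l) → NoDup p
  noDup-prefix []      l _          = tt
  noDup-prefix (x ∷ p) l (x∉ , nd) = (λ x∈p → x∉ (∈-++⁺ˡ x∈p)) , noDup-prefix p l nd

  noDup-∉-prefix : ∀ x p l → NoDup (p ++ x ∷ l) → x ∉ p
  noDup-∉-prefix x (y ∷ p) l (y∉ , nd) (here refl) = y∉ (∈-++⁺ʳ p (here refl))
  noDup-∉-prefix x (y ∷ p) l (y∉ , nd) (there x∈p) = noDup-∉-prefix x p l nd x∈p

  IsCycle : Vertex → List Vertex → Set
  IsCycle x p = NoDup (x ∷ p) × Walk (x ∷ p) × (endpoint x p ∼ x)

  ∈toList→lookup : ∀ {ℓ x} (s : Vec Vertex ℓ) → x ∈ toList s → ∃[ i ] V.lookup s i ≡ x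
  ∈toList→lookup (y V.∷ s) (here x≡y)  = Fin.zero , sym x≡y
  ∈toList→lookup (y V.∷ s) (there x∈s) with ∈toList→lookup s x∈s
  ... | i , eq = Fin.suc i , eq

  distinct→noDup : ∀ {ℓ} (s : Vec Vertex ℓ) → Distinct Γ s → NoDup (toList s)
  distinct→noDup V.[]       _        = tt
  distinct→noDup (x V.∷ s) distinct =
    (λ x∈s → let i , eq = ∈toList→lookup s x∈s in 0≢1+n (distinct Fin.zero (Fin.suc i) (sym eq))) ,
    distinct→noDup s (λ i j eq → suc-injectiveᶠ (distinct (Fin.suc i) (Fin.suc j) eq))

  noDup→distinct : ∀ {ℓ} (s : Vec Vertex ℓ) → NoDup (toList s) → Distinct Γ s
  noDup→distinct (x V.∷ s) (x∉ , nd) Fin.zero    Fin.zero    _  = refl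
  noDup→distinct (x V.∷ s) (x∉ , nd) Fin.zero    (Fin.suc j) eq =
    ⊥-elim (x∉ (∈-toList⁺ (subst (_∈ᵥ s) (sym eq) (∈-lookup j s))))
  noDup→distinct (x V.∷ s) (x∉ , nd) (Fin.suc i) Fin.zero    eq =
    ⊥-elim (x∉ (∈-toList⁺ (subst (_∈ᵥ s) eq (∈-lookup i s))))
  noDup→distinct (x V.∷ s) (x∉ , nd) (Fin.suc i) (Fin.suc j) eq = cong Fin.suc (noDup→distinct s nd i j eq)

  consecutive→walk : ∀ {ℓ} (s : Vec Vertex ℓ) → Consecutive Γ s → Walk (toList s)
  consecutive→walk V.[]                _          = tt
  consecutive→walk (x V.∷ V.[])        _          = tt
  consecutive→walk (x V.∷ y V.∷ s) (x∼y , c) = x∼y , consecutive→walk (y V.∷ s) c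

  walk→consecutive : ∀ {ℓ} (s : Vec Vertex ℓ) → Walk (toList s) → Consecutive Γ s
  walk→consecutive V.[]                _          = tt
  walk→consecutive (x V.∷ V.[])        _          = tt
  walk→consecutive (x V.∷ y V.∷ s) (x∼y , w) = x∼y , walk→consecutive (y V.∷ s) w

  last≡endpoint : ∀ {ℓ} x (s : Vec Vertex ℓ) → V.last (x V.∷ s) ≡ endpoint x (toList s)
  last≡endpoint x V.[]       = refl
  last≡endpoint x (y V.∷ s) = last≡endpoint y s

  cycleSeq→isCycle : ∀ {ℓ} x (s : Vec Vertex ℓ) → IsCycleSeq Γ ℓ (x V.∷ s) → IsCycle x (toList s)
  cycleSeq→isCycle x s (distinct , consecutive , closing) =
    distinct→noDup (x V.∷ s) distinct , consecutive→walk (x V.∷ s) consecutive ,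
    subst (_∼ x) (last≡endpoint x s) closing

  isCycle→cycleSeq : ∀ {ℓ} x (s : Vec Vertex ℓ) → IsCycle x (toList s) → IsCycleSeq Γ ℓ (x V.∷ s)
  isCycle→cycleSeq x s (nd , w , closing) =
    noDup→distinct (x V.∷ s) nd , walk→consecutive (x V.∷ s) w ,
    subst (_∼ x) (sym (last≡endpoint x s)) closing

  isCycle→hasCycle : ∀ x p → IsCycle x p → 2 ≤ length p → HasCycleOfLength Γ (suc (length p))
  isCycle→hasCycle x p cycle 2≤|p| =
    s≤s 2≤|p| , x V.∷ fromList p ,
    isCycle→cycleSeq x (fromList p) (subst (IsCycle x) (sym (toList∘fromList p)) cycle)

  -- A closed non-backtracking walk x ∷ p ++ x ∷ q has |p| ≥ 2, since Γ has
  -- no loops and the walk does not immediately return to x.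
  closed-walk-length : ∀ x p q → NBWalk (x ∷ p ++ x ∷ q) → 2 ≤ length p
  closed-walk-length x []          q ((x∼x , _) , _) = ⊥-elim (∼-irrefl x∼x)
  closed-walk-length x (y ∷ [])    q (_ , (x≢x , _)) = ⊥-elim (x≢x refl)
  closed-walk-length x (y ∷ z ∷ p) q _               = s≤s (s≤s z≤n)

  walk-prefix : ∀ x p y l → Walk (x ∷ p ++ y ∷ l) → Walk (x ∷ p) × endpoint x p ∼ y
  walk-prefix x []      y l (x∼y , _) = tt , x∼y
  walk-prefix x (z ∷ p) y l (x∼z , w) with walk-prefix z p y l w
  ... | w′ , closing = (x∼z , w′) , closing

  first-return : ∀ x p q → NBWalk (x ∷ p ++ x ∷ q) → NoDup (p ++ x ∷ q) → HasCycleOfLength Γ (suc (length p))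
  first-return x p q w nd =
    isCycle→hasCycle x p
      ((noDup-∉-prefix x p q nd , noDup-prefix p (x ∷ q) nd) , walk-prefix x p x q (proj₁ w))
      (closed-walk-length x p q w)

  cycle-in-walk : ∀ l → NBWalk l → ¬ NoDup l → ∃[ ℓ ] ℓ < length l × HasCycleOfLength Γ ℓ
  cycle-in-walk []      _ repeats = ⊥-elim (repeats tt)
  cycle-in-walk (x ∷ l) w repeats with noDup? l
  ... | no repeatsₗ with cycle-in-walk l (nbwalk-tail x l w) repeatsₗ
  ...   | ℓ , ℓ< , cycle = ℓ , m<n⇒m<1+n ℓ< , cycle
  cycle-in-walk (x ∷ l) w repeats | yes ndₗ with x ∈? l
  ... | no x∉l  = ⊥-elim (repeats (x∉l , ndₗ))
  ... | yes x∈l with ∈-∃++ x∈l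
  ...   | p , q , refl = suc (length p) , s≤s shorter , first-return x p q w ndₗ
    where
    shorter : length p < length (p ++ x ∷ q)
    shorter = subst (length p <_) (sym (length-++ p)) (m<m+n (length p) (s≤s z≤n))

  HeadsDiffer : List Vertex → List Vertex → Set
  HeadsDiffer (y ∷ _) (z ∷ _) = y ≢ z
  HeadsDiffer _       _       = ⊤

  reverse-onto : ∀ x xs acc → NBWalk (x ∷ xs) → NBWalk (x ∷ acc) → HeadsDiffer xs acc →
    NBWalk (xs ʳ++ x ∷ acc)
  reverse-onto x []       acc _                      w′         _   = w′
  reverse-onto x (y ∷ xs) acc w@((x∼y , _) , nbₓ) (w′ , nb′) y≢ =
    reverse-onto y xs (x ∷ acc) (nbwalk-tail x (y ∷ xs) w) ((∼-sym x∼y , w′) , turn acc nb′ y≢) (fresh xs nbₓ)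
    where
    turn : ∀ acc → NoBacktrack (x ∷ acc) → HeadsDiffer (y ∷ xs) acc → NoBacktrack (y ∷ x ∷ acc)
    turn []      _   _   = tt
    turn (z ∷ _) nb y≢z = y≢z , nb
    fresh : ∀ xs → NoBacktrack (x ∷ y ∷ xs) → HeadsDiffer xs (x ∷ acc)
    fresh []      _         = tt
    fresh (z ∷ _) (x≢z , _) = λ z≡x → x≢z (sym z≡x)

  ʳ++-noDup-acc : ∀ xs acc → NoDup (xs ʳ++ acc) → NoDup acc
  ʳ++-noDup-acc []       acc nd = nd
  ʳ++-noDup-acc (y ∷ xs) acc nd = proj₂ (ʳ++-noDup-acc xs (y ∷ acc) nd)

  ʳ++-repeats : ∀ {b} xs acc → b ∈ xs → b ∈ acc → ¬ NoDup (xs ʳ++ acc)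
  ʳ++-repeats (y ∷ xs) acc (here refl)  b∈acc nd = proj₁ (ʳ++-noDup-acc xs (y ∷ acc) nd) b∈acc
  ʳ++-repeats (y ∷ xs) acc (there b∈xs) b∈acc nd = ʳ++-repeats xs (y ∷ acc) b∈xs (there b∈acc) nd

  fork→cycle : ∀ a y Y z Z → y ≢ z → endpoint y Y ≡ endpoint z Z →
    NBWalk (a ∷ y ∷ Y) → NBWalk (a ∷ z ∷ Z) →
    ∃[ ℓ ] ℓ ≤ suc (length Y) + suc (length Z) × HasCycleOfLength Γ ℓ
  fork→cycle a y Y z Z y≢z same-end w w′
    with cycle-in-walk ((y ∷ Y) ʳ++ a ∷ z ∷ Z) (reverse-onto a (y ∷ Y) (z ∷ Z) w w′ y≢z)
           (ʳ++-repeats (y ∷ Y) (a ∷ z ∷ Z) (endpoint∈ y Y) (there (subst (_∈ z ∷ Z) (sym same-end) (endpoint∈ z Z))))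
  ... | ℓ , ℓ< , cycle = ℓ , ≤-pred bound , cycle
    where
    open ≤-Reasoning
    bound : ℓ < suc (suc (length Y) + suc (length Z))
    bound = begin-strict
      ℓ                                     <⟨ ℓ< ⟩
      length ((y ∷ Y) ʳ++ a ∷ z ∷ Z)        ≡⟨ length-ʳ++ (y ∷ Y) ⟩
      suc (length Y) + suc (suc (length Z)) ≡⟨ +-suc (suc (length Y)) (suc (length Z)) ⟩
      suc (suc (length Y) + suc (length Z)) ∎

  NoCycleUpTo : ℕ → Set
  NoCycleUpTo t = ∀ ℓ → ℓ ≤ t + t → ¬ HasCycleOfLength Γ ℓ

  girth→noCycleUpTo : ∀ {g} → HasGirth Γ g → ∀ t → t + t < g → NoCycleUpTo t
  girth→noCycleUpTo (_ , no-shorter) t 2t<g ℓ ℓ≤2t = no-shorter ℓ (≤-<-trans ℓ≤2t 2t<g)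

  walks-unique : ∀ a V V′ → length V ≡ length V′ → endpoint a V ≡ endpoint a V′ →
    NBWalk (a ∷ V) → NBWalk (a ∷ V′) → NoCycleUpTo (length V) → V ≡ V′
  walks-unique a []      []      _   _   _ _  _       = refl
  walks-unique a (y ∷ Y) (z ∷ Z) len end w w′ noCycle with y ≟ z
  ... | yes refl =
    cong (y ∷_) (walks-unique y Y Z (suc-injective len) end (nbwalk-tail a _ w) (nbwalk-tail a _ w′)
      (λ ℓ ℓ≤ → noCycle ℓ (≤-trans ℓ≤ (+-mono-≤ (n≤1+n _) (n≤1+n _)))))
  ... | no y≢z with fork→cycle a y Y z Z y≢z end w w′
  ...   | ℓ , ℓ≤ , cycle = ⊥-elim (noCycle ℓ (subst (λ t → ℓ ≤ suc (length Y) + t) (sym len) ℓ≤) cycle)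

  walk-snoc : ∀ x p y → Walk (x ∷ p) → endpoint x p ∼ y → Walk (x ∷ p ∷ʳ y)
  walk-snoc x []      y _         x∼y = x∼y , tt
  walk-snoc x (z ∷ p) y (x∼z , w) end = x∼z , walk-snoc z p y w end

  noBacktrack-snoc : ∀ y p → NoDup (y ∷ p) → NoBacktrack (p ∷ʳ y)
  noBacktrack-snoc y []              _                       = tt
  noBacktrack-snoc y (x ∷ [])        _                       = tt
  noBacktrack-snoc y (x ∷ z ∷ [])    (y∉ , _)                = (λ x≡y → y∉ (here (sym x≡y))) , tt
  noBacktrack-snoc y (x ∷ z ∷ w ∷ p) (y∉ , (x∉ , (z∉ , nd))) =
    (λ x≡w → x∉ (there (here x≡w))) ,
    noBacktrack-snoc y (z ∷ w ∷ p) ((λ y∈ → y∉ (there y∈)) , (z∉ , nd))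

  cycle-return : ∀ x y p → IsCycle x (y ∷ p) → NBWalk (y ∷ p ∷ʳ x)
  cycle-return x y p (nd , (_ , w) , closing) = walk-snoc y p x w closing , noBacktrack-snoc x (y ∷ p) nd

  length-∷ʳ : ∀ (l : List Vertex) x → length (l ∷ʳ x) ≡ suc (length l)
  length-∷ʳ l x = trans (length-++ l) (+-comm (length l) 1)

  -- A cycle u, v, P, Q through the edge uv is determined by u, v, P when Γ
  -- has no cycle of length at most 2(|Q| + 1): the stretch from the end of P
  -- back to u is a non-backtracking walk of length |Q| + 1.
  cycle-determined : ∀ u v P Q Q′ → IsCycle u (v ∷ P ++ Q) → IsCycle u (v ∷ P ++ Q′) →
    length Q ≡ length Q′ → NoCycleUpTo (suc (length Q)) → Q ≡ Q′
  cycle-determined u v P Q Q′ cycle cycle′ len noCycle =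
    ∷ʳ-injectiveˡ Q Q′ (walks-unique (endpoint v P) (Q ∷ʳ u) (Q′ ∷ʳ u)
      (trans (length-∷ʳ Q u) (trans (cong suc len) (sym (length-∷ʳ Q′ u))))
      (trans (endpoint-∷ʳ _ Q u) (sym (endpoint-∷ʳ _ Q′ u)))
      (rest cycle) (rest cycle′)
      (subst NoCycleUpTo (sym (length-∷ʳ Q u)) noCycle))
    where
    rest : ∀ {R} → IsCycle u (v ∷ P ++ R) → NBWalk (endpoint v P ∷ R ∷ʳ u)
    rest {R} c = nbwalk-suffix v P (R ∷ʳ u)
      (subst (λ l → NBWalk (v ∷ l)) (++-assoc P R [ u ]) (cycle-return u v (P ++ R) c))

  count : ∀ {ℓ} {P : Vec Vertex ℓ → Set} → Decidable P → ℕ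
  count {ℓ} P? = length (filter P? (allVecs Γ ℓ))

  count-by-head : ∀ {ℓ} {P : Vec Vertex (suc ℓ) → Set} (P? : Decidable P) →
    count P? ≡ sum (map (λ x → count (P? ∘ (x V.∷_))) (vertices Γ))
  count-by-head {ℓ} P? =
    trans (length-filter-concatMap P? (λ x → map (x V.∷_) (allVecs Γ ℓ)) (vertices Γ))
          (cong sum (map-cong (λ x → length-filter-map P? (x V.∷_) (allVecs Γ ℓ)) (vertices Γ)))

  count≤1 : ∀ ℓ {P : Vec Vertex ℓ → Set} (P? : Decidable P) → (∀ r r′ → P r → P r′ → r ≡ r′) → count P? ≤ 1
  count≤1 zero    P? _      = length-filter P? (V.[] ∷ [])
  count≤1 (suc ℓ) P? unique = subst (_≤ 1) (sym (count-by-head P?))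
    (sum-atMost1 (λ x → count (P? ∘ (x V.∷_))) (vertices Γ) (allFin⁺ n)
      (λ x → count≤1 ℓ (P? ∘ (x V.∷_)) (λ r r′ p p′ → ∷-injectiveʳ (unique _ _ p p′)))
      same-head)
    where
    same-head : ∀ x y → 0 < count (P? ∘ (x V.∷_)) → 0 < count (P? ∘ (y V.∷_)) → x ≡ y
    same-head x y some some′ with filter-witness (P? ∘ (x V.∷_)) (allVecs Γ ℓ) some
                                | filter-witness (P? ∘ (y V.∷_)) (allVecs Γ ℓ) some′
    ... | r , p | r′ , p′ = ∷-injectiveˡ (unique _ _ p p′)

  module _ {k : ℕ} (regular : Regular Γ k) where

    other-neighbours : ∀ a b → a ∼ b →
      length (filter (λ x → _~?_ Γ b x ×-dec ¬? (x ≟ a)) (vertices Γ)) ≤ k ∸ 1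
    other-neighbours a b a∼b = <⇒≤∸1 (begin-strict
      length (filter (λ x → _~?_ Γ b x ×-dec ¬? (x ≟ a)) (vertices Γ))
        ≡⟨ cong length (filter-× (_~?_ Γ b) (λ x → ¬? (x ≟ a)) (vertices Γ)) ⟩
      length (filter (λ x → ¬? (x ≟ a)) (neighbours Γ b))
        <⟨ filter-notAll (λ x → ¬? (x ≟ a)) (neighbours Γ b) (Any.map (λ a≡x x≢a → x≢a (sym a≡x)) a∈N) ⟩
      degree Γ b
        ≡⟨ regular b ⟩
      k ∎)
      where
      open ≤-Reasoning
      a∈N : a ∈ neighbours Γ b
      a∈N = ∈-filter⁺ (_~?_ Γ b) (∈-allFin a) (∼-sym a∼b)

    -- The vectors r that extend the edge a → b to a non-backtracking walk
    -- a ∷ b ∷ r and are determined by their first j entries number at most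
    -- (k - 1)^j: each of the first j steps has at most k - 1 choices.
    extensions-bound : ∀ j ℓ → j ≤ ℓ → ∀ a b {P : Vec Vertex ℓ → Set} (P? : Decidable P) → a ∼ b →
      (∀ r → P r → NBWalk (a ∷ b ∷ toList r)) →
      (∀ r r′ → P r → P r′ → take j (toList r) ≡ take j (toList r′) → r ≡ r′) →
      count P? ≤ (k ∸ 1) ^ j
    extensions-bound zero ℓ _ a b P? _ _ determined = count≤1 ℓ P? (λ r r′ p p′ → determined r r′ p p′ refl)
    extensions-bound (suc j) (suc ℓ) (s≤s j≤ℓ) a b {P} P? a∼b extends determined = begin
      count P?                                      ≡⟨ count-by-head P? ⟩
      sum (map f (vertices Γ))                      ≤⟨ sum-bound S? f ((k ∸ 1) ^ j) (vertices Γ) step-bound off-step ⟩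
      length (filter S? (vertices Γ)) * (k ∸ 1) ^ j ≤⟨ *-monoˡ-≤ ((k ∸ 1) ^ j) (other-neighbours a b a∼b) ⟩
      (k ∸ 1) * (k ∸ 1) ^ j                         ∎
      where
      open ≤-Reasoning
      f : Vertex → ℕ
      f x = count (P? ∘ (x V.∷_))
      S : Vertex → Set
      S x = b ∼ x × x ≢ a
      S? : Decidable S
      S? x = _~?_ Γ b x ×-dec ¬? (x ≟ a)
      step-bound : ∀ x → S x → f x ≤ (k ∸ 1) ^ j
      step-bound x (b∼x , _) =
        extensions-bound j ℓ j≤ℓ b x (P? ∘ (x V.∷_)) b∼x
          (λ r p → nbwalk-tail a _ (extends (x V.∷ r) p))
          (λ r r′ p p′ agree → ∷-injectiveʳ (determined _ _ p p′ (cong (x ∷_) agree)))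
      off-step : ∀ x → ¬ S x → f x ≡ 0
      off-step x ¬S = cong length (filter-none (P? ∘ (x V.∷_)) (All.universal next (allVecs Γ ℓ)))
        where
        next : ∀ r → ¬ P (x V.∷ r)
        next r p with extends (x V.∷ r) p
        ... | (_ , b∼x , _) , (a≢x , _) = ¬S (b∼x , λ x≡a → a≢x (sym x≡a))

    -- Each edge uv lies on at most (k - 1)^⌊g/2⌋ girth cycles: girth cycle
    -- sequences u, v, r are non-backtracking walks, and any two of them
    -- agreeing in the first d = ⌊g/2⌋ entries of r coincide, because the
    -- remaining stretches back to u have length ⌊(g-1)/2⌋ < g/2.
    ε-bound : ∀ {g} → HasGirth Γ g → ∀ u v → u ∼ v → ε Γ g u v ≤ (k ∸ 1) ^ ⌊ g /2⌋
    ε-bound {zero}        (() , _)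
    ε-bound {suc zero}    ((s≤s () , _) , _)
    ε-bound {suc (suc m)} girth@((s≤s (s≤s 1≤m) , _) , _) u v u∼v =
      extensions-bound d m (half≤ m 1≤m) u v (λ r → isCycleSeq? Γ (suc m) (u V.∷ v V.∷ r)) u∼v extends determined
      where
      d : ℕ
      d = ⌊ suc (suc m) /2⌋
      GirthCycle : Vec Vertex m → Set
      GirthCycle r = IsCycleSeq Γ (suc m) (u V.∷ v V.∷ r)

      extends : ∀ r → GirthCycle r → NBWalk (u ∷ v ∷ toList r)
      extends r c with cycleSeq→isCycle u (v V.∷ r) c
      ... | nd , w , _ = w , noDup→noBacktrack (u ∷ v ∷ toList r) nd

      split : ∀ r → GirthCycle r → IsCycle u (v ∷ take d (toList r) ++ drop d (toList r))
      split r c = subst (λ l → IsCycle u (v ∷ l)) (sym (take++drop≡id d (toList r))) (cycleSeq→isCycle u (v V.∷ r) c)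

      rest-length : ∀ (r : Vec Vertex m) → length (drop d (toList r)) ≡ m ∸ d
      rest-length r = trans (length-drop d (toList r)) (cong (_∸ d) (length-toList r))

      short-cycles-absent : ∀ r → NoCycleUpTo (suc (length (drop d (toList r))))
      short-cycles-absent r = girth→noCycleUpTo girth (suc (length (drop d (toList r))))
        (subst (λ t → t + t < suc (suc m)) (sym (trans (cong suc (rest-length r)) (remaining-length m 1≤m)))
               (s≤s (⌊n/2⌋+⌊n/2⌋≤n (suc m))))

      determined : ∀ r r′ → GirthCycle r → GirthCycle r′ → take d (toList r) ≡ take d (toList r′) → r ≡ r′
      determined r r′ c c′ agree = toList-injective≡ r r′ (begin
        toList r                                 ≡⟨ take++drop≡id d (toList r) ⟨
        take d (toList r) ++ drop d (toList r)   ≡⟨ cong₂ _++_ agree same-rest ⟩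
        take d (toList r′) ++ drop d (toList r′) ≡⟨ take++drop≡id d (toList r′) ⟩
        toList r′                                ∎)
        where
        open ≡-Reasoning
        same-rest : drop d (toList r) ≡ drop d (toList r′)
        same-rest = cycle-determined u v (take d (toList r)) (drop d (toList r)) (drop d (toList r′))
          (split r c) (subst (λ P → IsCycle u (v ∷ P ++ drop d (toList r′))) (sym agree) (split r′ c′))
          (trans (rest-length r) (sym (rest-length r′))) (short-cycles-absent r)

last∈ : ∀ {A : Set} (xs : List A) {a} → last xs ≡ just a → a ∈ xs
last∈ (x ∷ [])     eq = here (sym (just-injective eq))
last∈ (x ∷ y ∷ xs) eq = there (last∈ (y ∷ xs) eq)

signature-entry-bound : ∀ Γ {k g} → Regular Γ k → HasGirth Γ g →
  ∀ v {a} → a ∈ signature Γ g v → a ≤ (k ∸ 1) ^ ⌊ g /2⌋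
signature-entry-bound Γ {g = g} regular girth v a∈ with ∈-map⁻ (ε Γ g v) (∈-resp-↭ (sort-↭ _) a∈)
... | w , w∈N , refl = ε-bound Γ regular girth v w (proj₂ (∈-filter⁻ (_~?_ Γ v) {xs = vertices Γ} w∈N))

cycle-vertex : ∀ Γ {ℓ} → HasCycleOfLength Γ ℓ → Fin (Graph.n Γ)
cycle-vertex Γ {suc ℓ} (_ , s , _) = V.head s

theorem1p2 : (Γ : Graph) (k g : ℕ) (σ : List ℕ) →
    Regular Γ k → HasGirth Γ g → GirthRegularWithSignature Γ g σ →
    (aₖ : ℕ) → last σ ≡ just aₖ → aₖ ≤ (k ∸ 1) ^ (g / 2)
theorem1p2 Γ k g σ regular girth girth-regular aₖ last≡ = begin
  aₖ                ≤⟨ signature-entry-bound Γ regular girth v aₖ∈signature ⟩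
  (k ∸ 1) ^ ⌊ g /2⌋ ≡⟨ cong ((k ∸ 1) ^_) (/2≡⌊/2⌋ g) ⟨
  (k ∸ 1) ^ (g / 2) ∎
  where
  open ≤-Reasoning
  v : Fin (Graph.n Γ)
  v = cycle-vertex Γ (proj₁ girth)
  aₖ∈signature : aₖ ∈ signature Γ g v
  aₖ∈signature = subst (aₖ ∈_) (sym (girth-regular v)) (last∈ σ last≡)
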